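{- For every integer $d\ge 8$ there exists a non-traceable plane triangulation with exactly $d$ $3$-cuts.
   Context: A triangulation is a plane graph all of whose faces are triangles (simple, with at least 4 vertices). A $3$-cut of $G$ is a set $S\subset V(G)$, $|S|=3$, such that $G-S$ has more components than $G$. A graph is traceable if it has a hamiltonian path. -}

module Defs where

open import Data.Nat using (ℕ; _≤_; _+_; _*_)
open import Data.Fin using (Fin; _<_; _≟_)
open import Data.Bool using (Bool; _∨_; _∧_)
open import Data.List using (List; length; filterᵇ)
open import Data.List.Membership.Propositional using (_∈_)
open import Data.List.Relation.Unary.All using (All)
open import Data.List.Relation.Unary.Unique.Propositional using (Unique)
open import Data.List.Relation.Unary.Linked using (Linked)
open import Data.Product using (Σ; ∃; _×_; _,_)
open import Data.Sum using (_⊎_)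
open import Relation.Nullary using (¬_)
open import Relation.Nullary.Decidable using (⌊_⌋)
open import Relation.Binary.PropositionalEquality using (_≡_; _≢_)
open import Relation.Binary.Construct.Closure.ReflexiveTransitive using (Star)
open import Function.Bundles using (_⇔_)

Tri : ℕ → Set
Tri n = Fin n × Fin n × Fin n

-- canonical (strictly increasing) form of a 3-element set {a,b,c}
Ordered : ∀ {n} → Tri n → Set
Ordered (a , b , c) = a < b × b < c

_∈T_ : ∀ {n} → Fin n → Tri n → Set
v ∈T (a , b , c) = v ≡ a ⊎ v ≡ b ⊎ v ≡ c

_∈ᵇ_ : ∀ {n} → Fin n → Tri n → Bool
v ∈ᵇ (a , b , c) = ⌊ v ≟ a ⌋ ∨ ⌊ v ≟ b ⌋ ∨ ⌊ v ≟ c ⌋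

_∉T_ : ∀ {n} → Fin n → Tri n → Set
v ∉T S = ¬ (v ∈T S)

Graph : ℕ → Set₁
Graph n = Fin n → Fin n → Set

Connected : ∀ {n} → Graph n → Set
Connected {n} G = (u v : Fin n) → Star G u v

_─_ : ∀ {n} → Graph n → Tri n → Graph n
(G ─ S) u v = u ∉T S × v ∉T S × G u v

-- S is a cut: removing S increases the number of components, i.e. two vertices
-- outside S that were in the same component of G are in different components
-- of G - S  (this is exactly "more components" for the connected graphs used here)
IsCut : ∀ {n} → Graph n → Tri n → Set
IsCut G S = ∃ λ u → ∃ λ v → u ∉T S × v ∉T S × Star G u v × ¬ Star (G ─ S) u v

Is3Cut : ∀ {n} → Graph n → Tri n → Set
Is3Cut G S = Ordered S × IsCut G S

Has3Cuts : ∀ {n} → Graph n → ℕ → Set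
Has3Cuts {n} G d =
  Σ (List (Tri n)) λ L → Unique L × ((S : Tri n) → (S ∈ L ⇔ Is3Cut G S)) × length L ≡ d

Traceable : ∀ {n} → Graph n → Set
Traceable {n} G = Σ (List (Fin n)) λ p → Unique p × length p ≡ n × Linked G p

-- Plane triangulations, combinatorially: a simplicial 2-sphere given by its
-- list of triangular faces on vertex set Fin n.

Adj : ∀ {n} → List (Tri n) → Graph n
Adj F u v = u ≢ v × ∃ λ f → f ∈ F × u ∈T f × v ∈T f

edgeDeg : ∀ {n} → List (Tri n) → Fin n → Fin n → ℕ
edgeDeg F u v = length (filterᵇ (λ f → u ∈ᵇ f Data.Bool.∧ v ∈ᵇ f) F)

LinkAdj : ∀ {n} → List (Tri n) → Fin n → Graph n
LinkAdj F v a b = v ≢ a × v ≢ b × a ≢ b × ∃ λ f → f ∈ F × v ∈T f × a ∈T f × b ∈T f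

record Triangulation (n : ℕ) : Set where
  field
    faces     : List (Tri n)
    four≤n    : 4 ≤ n
    ordered   : All Ordered faces
    unique    : Unique faces
    -- closed surface: every edge lies on exactly two faces, and the link of
    -- every vertex (a union of cycles) is connected, i.e. a single cycle
    edge-two  : (u v : Fin n) → Adj faces u v → edgeDeg faces u v ≡ 2
    link-conn : (v a b : Fin n) → Adj faces v a → Adj faces v b → Star (LinkAdj faces v) a b
    connected : Connected (Adj faces)
    -- Euler characteristic V - E + F = 2 (with 2E = 3F this is F = 2V - 4): a sphere
    euler     : length faces + 4 ≡ 2 * n

  graph : Graph n
  graph = Adj faces

module Submission where

-- Start from a 4-connected triangulation (the octahedron, or the pentagonal bipyramid), in which
-- no three vertices separate, and repeatedly stack a new vertex into a face. Stacking into a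
-- face f of a 3-connected triangulation keeps it 3-connected, keeps every old 3-cut, and creates
-- exactly one new 3-cut, namely f; so d stackings give exactly d 3-cuts. A vertex stacked into a
-- face avoiding an independent set I may join I, and once 2|I| ≥ n + 2 there is no hamiltonian
-- path, since at most every other vertex of a path lies in I. Stacking into all eight faces of
-- the octahedron gives d = 8. For d ≥ 9, stack nine times into the bipyramid, then alternately
-- stack a vertex that stays outside I (creating three fresh faces) and one that joins I, which
-- preserves n + 2 ≤ 2|I|; a final lone stacking handles odd remainders.

open import Defs
open import Data.Nat as ℕ using (ℕ; zero; suc; _+_; _*_; _≤_; z≤n; s≤s)
open import Data.Nat.Tactic.RingSolver using (solve-∀)
import Data.Nat.Properties as ℕ
open import Data.Fin as Fin using (Fin; zero; suc; _≟_; inject≤; #_)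
import Data.Fin.Properties as Fin
open import Data.Bool using (Bool; T; _∧_; _∨_)
open import Data.Bool.Properties using (T-∧; T-∨)
open import Data.List using (List; []; _∷_; _++_; length; filter; filterᵇ; lookup; map)
import Data.List.Properties as List
import Data.List.Relation.Unary.All.Properties as All
import Data.List.Relation.Unary.Unique.Propositional.Properties as Unique
open import Data.List.Membership.Propositional using (_∈_; find; lose)
open import Data.List.Membership.Propositional.Properties using (∈-++⁺ˡ; ∈-++⁺ʳ; ∈-++⁻; ∈-map⁺; ∈-map⁻; ∈-∃++; ∈-lookup; ∈-filter⁻)
open import Data.List.Relation.Unary.Any as Any using (here; there)
open import Data.List.Relation.Unary.All as All using (All; []; _∷_)
open import Data.List.Relation.Unary.AllPairs as AllPairs using ([]; _∷_)
open import Data.List.Relation.Unary.Unique.Propositional using (Unique)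
open import Data.List.Relation.Unary.Linked using (Linked; []; [-]; _∷_)
open import Data.Vec as Vec using (Vec)
import Data.Vec.Properties as Vec
open import Data.Product using (Σ; ∃; _×_; _,_; proj₁; proj₂; swap)
open import Data.Product.Properties using (≡-dec)
import Data.Sum
open import Data.Sum using (_⊎_; inj₁; inj₂)
open import Data.Empty using (⊥; ⊥-elim)
open import Data.Unit using (tt)
open import Function using (_∘_)
open import Function.Bundles using (Equivalence; _⇔_; mk⇔)
open import Relation.Binary.Definitions using (DecidableEquality)
open import Relation.Nullary using (¬_; Dec; yes; no; ¬?)
import Relation.Nullary.Decidable as Dec
open import Relation.Nullary.Decidable using (True; ⌊_⌋; _⊎-dec_; _×-dec_; _→-dec_; toWitness; fromWitness; T?)
open import Relation.Binary.PropositionalEquality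
open import Algebra.Properties.CommutativeSemigroup ℕ.+-commutativeSemigroup using (x∙yz≈y∙xz)
open import Relation.Binary.Construct.Closure.ReflexiveTransitive as Star using (Star; ε; _◅_; _◅◅_)

∈-++-insert : ∀ {A : Set} xs {y z : A} {ys} → z ∈ xs ++ ys → z ∈ xs ++ y ∷ ys
∈-++-insert xs z∈ = Data.Sum.[ ∈-++⁺ˡ , ∈-++⁺ʳ xs ∘ there ] (∈-++⁻ xs z∈)

∈-++-remove : ∀ {A : Set} xs {y z : A} {ys} → z ∈ xs ++ y ∷ ys → z ≡ y ⊎ z ∈ xs ++ ys
∈-++-remove xs z∈ with ∈-++⁻ xs z∈
... | inj₁ z∈xs = inj₂ (∈-++⁺ˡ z∈xs)
... | inj₂ (here z≡y) = inj₁ z≡y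
... | inj₂ (there z∈ys) = inj₂ (∈-++⁺ʳ xs z∈ys)

length-insert : ∀ {A : Set} xs {y : A} {ys} → length (xs ++ y ∷ ys) ≡ suc (length (xs ++ ys))
length-insert [] = refl
length-insert (x ∷ xs) = cong suc (length-insert xs)

Unique-remove : ∀ {A : Set} xs {y : A} {ys} → Unique (xs ++ y ∷ ys) → All (y ≢_) (xs ++ ys) × Unique (xs ++ ys)
Unique-remove [] (y∉ys ∷ ys!) = y∉ys , ys!
Unique-remove (x ∷ xs) (x∉ ∷ xs!) with y∉ , xs++ys! ← Unique-remove xs xs! =
  (λ y≡x → All.lookup x∉ (∈-++⁺ʳ xs (here refl)) (sym y≡x)) ∷ y∉ ,
  All.tabulate (All.lookup x∉ ∘ ∈-++-insert xs) ∷ xs++ys!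

lookup-injective : ∀ {A : Set} {xs : List A} → Unique xs → ∀ i j → lookup xs i ≡ lookup xs j → i ≡ j
lookup-injective {xs = _ ∷ _} _ zero zero _ = refl
lookup-injective {xs = _ ∷ _} (x∉ ∷ _) zero (suc j) x≡ = ⊥-elim (All.lookup x∉ (∈-lookup j) x≡)
lookup-injective {xs = _ ∷ _} (x∉ ∷ _) (suc i) zero ≡x = ⊥-elim (All.lookup x∉ (∈-lookup i) (sym ≡x))
lookup-injective {xs = _ ∷ _} (_ ∷ xs!) (suc i) (suc j) eq = cong suc (lookup-injective xs! i j eq)

Unique-length≤ : ∀ {n} {xs : List (Fin n)} → Unique xs → length xs ≤ n
Unique-length≤ xs! = Fin.injective⇒≤ (lookup-injective xs! _ _)

_∈T?_ : ∀ {n} (v : Fin n) (g : Tri n) → Dec (v ∈T g)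
v ∈T? (a , b , c) = v ≟ a ⊎-dec v ≟ b ⊎-dec v ≟ c

_≟T_ : ∀ {n} → DecidableEquality (Tri n)
_≟T_ = ≡-dec _≟_ (≡-dec _≟_ _≟_)

corner : ∀ {n} → Tri n → Fin 3 → Fin n
corner (a , b , c) zero = a
corner (a , b , c) (suc zero) = b
corner (a , b , c) (suc (suc zero)) = c

corner-∈T : ∀ {n} {v : Fin n} {g} → v ∈T g → ∃ λ k → corner g k ≡ v
corner-∈T (inj₁ refl) = zero , refl
corner-∈T (inj₂ (inj₁ refl)) = suc zero , refl
corner-∈T (inj₂ (inj₂ refl)) = suc (suc zero) , refl

∃∉T : ∀ {n} → 4 ≤ n → (g : Tri n) → ∃ λ v → v ∉T g
∃∉T 4≤n g = let i , i∉g = Fin.¬∀⟶∃¬ 4 _ (λ i → inject≤ i 4≤n ∈T? g) all-in-impossible in inject≤ i 4≤n , i∉g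
  where
  -- four distinct vertices cannot fit in the three corners of g
  all-in-impossible : ¬ (∀ i → inject≤ i 4≤n ∈T g)
  all-in-impossible all-in
    with i , j , i<j , same ← Fin.pigeonhole (ℕ.n<1+n 3) (proj₁ ∘ corner-∈T ∘ all-in) =
    Fin.<⇒≢ i<j (Fin.inject≤-injective 4≤n 4≤n i j (begin
      inject≤ i 4≤n                           ≡⟨ sym (proj₂ (corner-∈T (all-in i))) ⟩
      corner g (proj₁ (corner-∈T (all-in i))) ≡⟨ cong (corner g) same ⟩
      corner g (proj₁ (corner-∈T (all-in j))) ≡⟨ proj₂ (corner-∈T (all-in j)) ⟩
      inject≤ j 4≤n                           ∎))
    where open ≡-Reasoning

module _ {n} {p q r : Fin n} (p<q : p Fin.< q) (q<r : q Fin.< r) where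

  private
    S : Tri n
    S = p , q , r

  ∈T-sorted-above-p : ∀ {x} → x ∈T S → p Fin.< x → x ≡ q ⊎ x ≡ r
  ∈T-sorted-above-p (inj₁ refl) p<p = ⊥-elim (Fin.<-irrefl refl p<p)
  ∈T-sorted-above-p (inj₂ x∈qr) _ = x∈qr

  ∈T-sorted-above-q : ∀ {x} → x ∈T S → q Fin.< x → x ≡ r
  ∈T-sorted-above-q (inj₁ refl) q<p = ⊥-elim (Fin.<-asym p<q q<p)
  ∈T-sorted-above-q (inj₂ (inj₁ refl)) q<q = ⊥-elim (Fin.<-irrefl refl q<q)
  ∈T-sorted-above-q (inj₂ (inj₂ refl)) _ = refl

  ∈T-sorted-not-above-r : ∀ {x} → x ∈T S → ¬ r Fin.< x
  ∈T-sorted-not-above-r x∈S r<x with ∈T-sorted-above-q x∈S (Fin.<-trans q<r r<x)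
  ... | refl = Fin.<-irrefl refl r<x

  sorted-∈T-unique : ∀ {a b c} → a Fin.< b → b Fin.< c →
                     a ∈T S → b ∈T S → c ∈T S → S ≡ (a , b , c)
  sorted-∈T-unique a<b b<c (inj₁ refl) b∈S c∈S with ∈T-sorted-above-p b∈S a<b
  ... | inj₁ refl = cong (λ z → p , q , z) (sym (∈T-sorted-above-q c∈S b<c))
  ... | inj₂ refl = ⊥-elim (∈T-sorted-not-above-r c∈S b<c)
  sorted-∈T-unique a<b b<c (inj₂ (inj₁ refl)) b∈S c∈S with ∈T-sorted-above-q b∈S a<b
  ... | refl = ⊥-elim (∈T-sorted-not-above-r c∈S b<c)
  sorted-∈T-unique a<b b<c (inj₂ (inj₂ refl)) b∈S c∈S = ⊥-elim (∈T-sorted-not-above-r b∈S a<b)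

sucT : ∀ {n} → Tri n → Tri (suc n)
sucT (a , b , c) = suc a , suc b , suc c

∈T-sucT⁺ : ∀ {n} {v : Fin n} {g} → v ∈T g → suc v ∈T sucT g
∈T-sucT⁺ (inj₁ refl) = inj₁ refl
∈T-sucT⁺ (inj₂ (inj₁ refl)) = inj₂ (inj₁ refl)
∈T-sucT⁺ (inj₂ (inj₂ refl)) = inj₂ (inj₂ refl)

∈T-sucT⁻ : ∀ {n} {v : Fin n} {g} → suc v ∈T sucT g → v ∈T g
∈T-sucT⁻ (inj₁ refl) = inj₁ refl
∈T-sucT⁻ (inj₂ (inj₁ refl)) = inj₂ (inj₁ refl)
∈T-sucT⁻ (inj₂ (inj₂ refl)) = inj₂ (inj₂ refl)

zero∉sucT : ∀ {n} {g : Tri n} → zero ∉T sucT g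
zero∉sucT (inj₁ ())
zero∉sucT (inj₂ (inj₁ ()))
zero∉sucT (inj₂ (inj₂ ()))

sucT-ordered : ∀ {n} {g : Tri n} → Ordered g → Ordered (sucT g)
sucT-ordered {g = _ , _ , _} (p<q , q<r) = ℕ.s<s p<q , ℕ.s<s q<r

Ordered-view : ∀ {n} (S′ : Tri (suc n)) → Ordered S′ →
               (∃ λ S → S′ ≡ sucT S × Ordered S) ⊎ (∃ λ q → ∃ λ r → S′ ≡ (zero , suc q , suc r))
Ordered-view (zero , suc q , suc r) _ = inj₂ (q , r , refl)
Ordered-view (suc p , suc q , suc r) (ℕ.s<s p<q , ℕ.s<s q<r) = inj₁ ((p , q , r) , refl , p<q , q<r)
Ordered-view (zero , zero , _) (() , _)
Ordered-view (zero , suc q , zero) (_ , ())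
Ordered-view (suc p , zero , _) (() , _)
Ordered-view (suc p , suc q , zero) (_ , ())

sucT-injective : ∀ {n} {g h : Tri n} → sucT g ≡ sucT h → g ≡ h
sucT-injective {g = _ , _ , _} {_ , _ , _} refl = refl

∈T⇒∈ᵇ : ∀ {n} {v : Fin n} {g} → v ∈T g → T (v ∈ᵇ g)
∈T⇒∈ᵇ {v = v} {a , b , c} = Equivalence.from T-∨ ∘
  Data.Sum.map (fromWitness {a? = v ≟ a}) (Equivalence.from T-∨ ∘ Data.Sum.map (fromWitness {a? = v ≟ b}) (fromWitness {a? = v ≟ c}))

∈ᵇ⇒∈T : ∀ {n} {v : Fin n} {g} → T (v ∈ᵇ g) → v ∈T g
∈ᵇ⇒∈T {v = v} {a , b , c} = Data.Sum.map (toWitness {a? = v ≟ a})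
  (Data.Sum.map (toWitness {a? = v ≟ b}) (toWitness {a? = v ≟ c}) ∘ Equivalence.to T-∨) ∘ Equivalence.to T-∨

-- Counting the faces at an edge

edgeIn : ∀ {n} → Fin n → Fin n → Tri n → Bool
edgeIn u v f = u ∈ᵇ f ∧ v ∈ᵇ f

-- A witness that exactly k faces of F contain both u and v; being a data type it can be built
-- by unification against a concrete face list, which the filter inside edgeDeg cannot.
data EdgeCount {n} (u v : Fin n) : List (Tri n) → ℕ → Set where
  []   : EdgeCount u v [] 0
  _∈∷_ : ∀ {g F k} → u ∈T g × v ∈T g → EdgeCount u v F k → EdgeCount u v (g ∷ F) (suc k)
  _∉∷_ : ∀ {g F k} → ¬ (u ∈T g × v ∈T g) → EdgeCount u v F k → EdgeCount u v (g ∷ F) k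

infixr 5 _∈∷_ _∉∷_

edgeDeg-count : ∀ {n} {u v : Fin n} {F k} → EdgeCount u v F k → edgeDeg F u v ≡ k
edgeDeg-count [] = refl
edgeDeg-count {u = u} {v} ((u∈g , v∈g) ∈∷ c) = trans
  (cong length (List.filter-accept (T? ∘ edgeIn u v) (Equivalence.from T-∧ (∈T⇒∈ᵇ u∈g , ∈T⇒∈ᵇ v∈g))))
  (cong suc (edgeDeg-count c))
edgeDeg-count {u = u} {v} (uv∉g ∉∷ c) = trans
  (cong length (List.filter-reject (T? ∘ edgeIn u v)
    λ t → let tu , tv = Equivalence.to T-∧ t in uv∉g (∈ᵇ⇒∈T tu , ∈ᵇ⇒∈T tv)))
  (edgeDeg-count c)

edgeCount : ∀ {n} {u v : Fin n} F → EdgeCount u v F (edgeDeg F u v)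
edgeCount {u = u} {v} F = let k , c = decide F in subst (EdgeCount u v F) (sym (edgeDeg-count c)) c
  where
  decide : ∀ F → ∃ (EdgeCount u v F)
  decide [] = 0 , []
  decide (g ∷ F) with u ∈T? g ×-dec v ∈T? g | decide F
  ... | yes uv∈g | k , c = suc k , uv∈g ∈∷ c
  ... | no uv∉g | k , c = k , uv∉g ∉∷ c

EdgeCount-swap : ∀ {n} {u v : Fin n} {F k} → EdgeCount u v F k → EdgeCount v u F k
EdgeCount-swap [] = []
EdgeCount-swap (uv∈g ∈∷ c) = swap uv∈g ∈∷ EdgeCount-swap c
EdgeCount-swap (uv∉g ∉∷ c) = uv∉g ∘ swap ∉∷ EdgeCount-swap c

EdgeCount-sucT : ∀ {n} {u v : Fin n} {F k} → EdgeCount u v F k → EdgeCount (suc u) (suc v) (map sucT F) k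
EdgeCount-sucT [] = []
EdgeCount-sucT ((u∈g , v∈g) ∈∷ c) = (∈T-sucT⁺ u∈g , ∈T-sucT⁺ v∈g) ∈∷ EdgeCount-sucT c
EdgeCount-sucT (uv∉g ∉∷ c) = (λ (u∈g , v∈g) → uv∉g (∈T-sucT⁻ u∈g , ∈T-sucT⁻ v∈g)) ∉∷ EdgeCount-sucT c

EdgeCount-none : ∀ {n} {u v : Fin n} {F} → (∀ {g} → g ∈ F → ¬ (u ∈T g × v ∈T g)) → EdgeCount u v F 0
EdgeCount-none {F = []} _ = []
EdgeCount-none {F = g ∷ F} uv∉F = uv∉F (here refl) ∉∷ EdgeCount-none (uv∉F ∘ there)

edgeDeg-sym : ∀ {n} F (u v : Fin n) → edgeDeg F u v ≡ edgeDeg F v u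
edgeDeg-sym F u v = sym (edgeDeg-count (EdgeCount-swap (edgeCount {u = u} {v} F)))

edgeDeg-map-sucT : ∀ {n} F (u v : Fin n) → edgeDeg (map sucT F) (suc u) (suc v) ≡ edgeDeg F u v
edgeDeg-map-sucT F u v = edgeDeg-count (EdgeCount-sucT (edgeCount {u = u} {v} F))

edgeDeg-map-sucT-zero : ∀ {n} (F : List (Tri n)) v → edgeDeg (map sucT F) zero v ≡ 0
edgeDeg-map-sucT-zero F v = edgeDeg-count (count F)
  where
  count : ∀ F → EdgeCount zero v (map sucT F) 0
  count [] = []
  count (_ ∷ F) = zero∉sucT ∘ proj₁ ∉∷ count F

edgeDeg-++ : ∀ {n} F F′ (u v : Fin n) → edgeDeg (F ++ F′) u v ≡ edgeDeg F u v + edgeDeg F′ u v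
edgeDeg-++ F F′ u v =
  trans (cong length (List.filter-++ (T? ∘ edgeIn u v) F F′)) (List.length-++ (filterᵇ (edgeIn u v) F))

edgeDeg-insert : ∀ {n} xs {g ys} (u v : Fin n) →
                 edgeDeg (xs ++ g ∷ ys) u v ≡ edgeDeg (g ∷ []) u v + edgeDeg (xs ++ ys) u v
edgeDeg-insert xs {g} {ys} u v = begin
  edgeDeg (xs ++ g ∷ ys) u v                                ≡⟨ edgeDeg-++ xs (g ∷ ys) u v ⟩
  edgeDeg xs u v + edgeDeg (g ∷ ys) u v                     ≡⟨ cong (edgeDeg xs u v +_) (edgeDeg-++ (g ∷ []) ys u v) ⟩
  edgeDeg xs u v + (edgeDeg (g ∷ []) u v + edgeDeg ys u v) ≡⟨ x∙yz≈y∙xz (edgeDeg xs u v) (edgeDeg (g ∷ []) u v) (edgeDeg ys u v) ⟩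
  edgeDeg (g ∷ []) u v + (edgeDeg xs u v + edgeDeg ys u v) ≡⟨ cong (edgeDeg (g ∷ []) u v +_) (edgeDeg-++ xs ys u v) ⟨
  edgeDeg (g ∷ []) u v + edgeDeg (xs ++ ys) u v             ∎
  where open ≡-Reasoning

Adj-sym : ∀ {n} {F : List (Tri n)} {u v} → Adj F u v → Adj F v u
Adj-sym (u≢v , g , g∈F , u∈g , v∈g) = u≢v ∘ sym , g , g∈F , v∈g , u∈g

LinkAdj-sym : ∀ {n} {F : List (Tri n)} {v a b} → LinkAdj F v a b → LinkAdj F v b a
LinkAdj-sym (v≢a , v≢b , a≢b , g , g∈F , v∈g , a∈g , b∈g) = v≢b , v≢a , a≢b ∘ sym , g , g∈F , v∈g , b∈g , a∈g

Connected─ : ∀ {n} → Graph n → Tri n → Set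
Connected─ {n} G S = ∀ {u v : Fin n} → u ∉T S → v ∉T S → Star (G ─ S) u v

ThreeConnected : ∀ {n} → Graph n → Set
ThreeConnected G = ∀ x y → Connected─ G (x , y , y)

Connected─⇒¬IsCut : ∀ {n} {G : Graph n} {S} → Connected─ G S → ¬ IsCut G S
Connected─⇒¬IsCut conn (_ , _ , u∉S , v∉S , _ , ¬path) = ¬path (conn u∉S v∉S)

Adj─-sym : ∀ {n} {F : List (Tri n)} {S u v} → (Adj F ─ S) u v → (Adj F ─ S) v u
Adj─-sym (u∉S , v∉S , adj) = v∉S , u∉S , Adj-sym adj

module _ {n} {G : Graph n} {I : List (Fin n)} (I-unique : Unique I)
         (I-independent : ∀ {u v} → u ∈ I → v ∈ I → ¬ G u v) where

  open import Data.List.Membership.DecPropositional (_≟_ {n}) using (_∈?_)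

  private
    inside outside : List (Fin n) → List (Fin n)
    inside = filter (_∈? I)
    outside = filter (¬? ∘ (_∈? I))

    length-inside-outside : ∀ p → length (inside p) + length (outside p) ≡ length p
    length-inside-outside [] = refl
    length-inside-outside (x ∷ p) with x ∈? I
    ... | yes _ = cong suc (length-inside-outside p)
    ... | no _ = trans (ℕ.+-suc _ _) (cong suc (length-inside-outside p))

    alternation : ∀ {p} → Linked G p → length (inside p) ≤ suc (length (outside p))
    alternation-from-outside : ∀ {x p} → ¬ x ∈ I → Linked G (x ∷ p) → length (inside (x ∷ p)) ≤ length (outside (x ∷ p))

    alternation [] = z≤n
    alternation {x ∷ []} [-] with x ∈? I
    ... | yes _ = s≤s z≤n
    ... | no _ = z≤n
    alternation {x ∷ _ ∷ _} (x~y ∷ linked) with x ∈? I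
    ... | yes x∈I = s≤s (alternation-from-outside (λ y∈I → I-independent x∈I y∈I x~y) linked)
    ... | no _ = ℕ.m≤n⇒m≤1+n (alternation linked)

    alternation-from-outside {x} x∉I [-] with x ∈? I
    ... | yes x∈I = ⊥-elim (x∉I x∈I)
    ... | no _ = z≤n
    alternation-from-outside {x} x∉I (_ ∷ linked) with x ∈? I
    ... | yes x∈I = ⊥-elim (x∉I x∈I)
    ... | no _ = alternation linked

    no-room : ∀ {k l} → k + l ≤ n → n ≤ suc (k + k) → n + 2 ≤ l + l → ⊥
    no-room {k} {l} k+l≤n n≤1+2k n+2≤2l = ℕ.<-irrefl refl (ℕ.≤-trans 2+2k≤n n≤1+2k)
      where
      open ℕ.≤-Reasoning
      2+2k≤n : suc (suc (k + k)) ≤ n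
      2+2k≤n = ℕ.+-cancelˡ-≤ n _ _ (begin
        n + suc (suc (k + k)) ≡⟨ n+[2+2k]≡[n+2]+2k n k ⟩
        (n + 2) + (k + k)     ≤⟨ ℕ.+-monoˡ-≤ (k + k) n+2≤2l ⟩
        (l + l) + (k + k)     ≡⟨ [l+l]+[k+k]≡[k+l]+[k+l] l k ⟩
        (k + l) + (k + l)     ≤⟨ ℕ.+-mono-≤ k+l≤n k+l≤n ⟩
        n + n                 ∎)
        where
        n+[2+2k]≡[n+2]+2k : ∀ n k → n + suc (suc (k + k)) ≡ (n + 2) + (k + k)
        n+[2+2k]≡[n+2]+2k = solve-∀
        [l+l]+[k+k]≡[k+l]+[k+l] : ∀ l k → (l + l) + (k + k) ≡ (k + l) + (k + l)
        [l+l]+[k+k]≡[k+l]+[k+l] = solve-∀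

  large-independent⇒¬Traceable : n + 2 ≤ length I + length I → ¬ Traceable G
  large-independent⇒¬Traceable n+2≤2I (p , p-unique , p-length , linked) =
    no-room {length (outside p)} outside+I≤n n≤1+2·outside n+2≤2I
    where
    outside+I≤n : length (outside p) + length I ≤ n
    outside+I≤n = subst (_≤ n) (List.length-++ (outside p)) (Unique-length≤
      (Unique.++⁺ (Unique.filter⁺ (¬? ∘ (_∈? I)) p-unique) I-unique
        λ (v∈outside , v∈I) → proj₂ (∈-filter⁻ (¬? ∘ (_∈? I)) {xs = p} v∈outside) v∈I))
    n≤1+2·outside : n ≤ suc (length (outside p) + length (outside p))
    n≤1+2·outside = subst (_≤ suc (length (outside p) + length (outside p))) (trans (length-inside-outside p) p-length)
      (ℕ.+-monoˡ-≤ (length (outside p)) (alternation linked))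

-- Stacking a vertex into a face

-- The stacked vertex is 0 and each old vertex v becomes suc v, so the cone faces stay sorted.
cone : ∀ {n} → Tri n → List (Tri (suc n))
cone (a , b , c) = (zero , suc a , suc b) ∷ (zero , suc a , suc c) ∷ (zero , suc b , suc c) ∷ []

module Cone {n} {a b c : Fin n} (a<b : a Fin.< b) (b<c : b Fin.< c) where

  private
    f : Tri n
    f = a , b , c
    a≢b : a ≢ b
    a≢b = Fin.<⇒≢ a<b
    b≢c : b ≢ c
    b≢c = Fin.<⇒≢ b<c
    a≢c : a ≢ c
    a≢c = Fin.<⇒≢ (Fin.<-trans a<b b<c)

  zero∈cone : ∀ {g} → g ∈ cone f → zero ∈T g
  zero∈cone (here refl) = inj₁ refl
  zero∈cone (there (here refl)) = inj₁ refl
  zero∈cone (there (there (here refl))) = inj₁ refl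

  cone-∈T⁻ : ∀ {g u} → g ∈ cone f → suc u ∈T g → u ∈T f
  cone-∈T⁻ (here refl) (inj₂ (inj₁ refl)) = inj₁ refl
  cone-∈T⁻ (here refl) (inj₂ (inj₂ refl)) = inj₂ (inj₁ refl)
  cone-∈T⁻ (there (here refl)) (inj₂ (inj₁ refl)) = inj₁ refl
  cone-∈T⁻ (there (here refl)) (inj₂ (inj₂ refl)) = inj₂ (inj₂ refl)
  cone-∈T⁻ (there (there (here refl))) (inj₂ (inj₁ refl)) = inj₂ (inj₁ refl)
  cone-∈T⁻ (there (there (here refl))) (inj₂ (inj₂ refl)) = inj₂ (inj₂ refl)

  cone-face : ∀ {u v} → u ∈T f → v ∈T f → ∃ λ g → g ∈ cone f × suc u ∈T g × suc v ∈T g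
  cone-face (inj₁ refl) (inj₁ refl) = _ , here refl , inj₂ (inj₁ refl) , inj₂ (inj₁ refl)
  cone-face (inj₁ refl) (inj₂ (inj₁ refl)) = _ , here refl , inj₂ (inj₁ refl) , inj₂ (inj₂ refl)
  cone-face (inj₁ refl) (inj₂ (inj₂ refl)) = _ , there (here refl) , inj₂ (inj₁ refl) , inj₂ (inj₂ refl)
  cone-face (inj₂ (inj₁ refl)) (inj₁ refl) = _ , here refl , inj₂ (inj₂ refl) , inj₂ (inj₁ refl)
  cone-face (inj₂ (inj₁ refl)) (inj₂ (inj₁ refl)) = _ , here refl , inj₂ (inj₂ refl) , inj₂ (inj₂ refl)
  cone-face (inj₂ (inj₁ refl)) (inj₂ (inj₂ refl)) = _ , there (there (here refl)) , inj₂ (inj₁ refl) , inj₂ (inj₂ refl)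
  cone-face (inj₂ (inj₂ refl)) (inj₁ refl) = _ , there (here refl) , inj₂ (inj₂ refl) , inj₂ (inj₁ refl)
  cone-face (inj₂ (inj₂ refl)) (inj₂ (inj₁ refl)) = _ , there (there (here refl)) , inj₂ (inj₂ refl) , inj₂ (inj₁ refl)
  cone-face (inj₂ (inj₂ refl)) (inj₂ (inj₂ refl)) = _ , there (here refl) , inj₂ (inj₂ refl) , inj₂ (inj₂ refl)

  cone-ordered : All Ordered (cone f)
  cone-ordered = (ℕ.z<s , ℕ.s<s a<b) ∷ (ℕ.z<s , ℕ.s<s (Fin.<-trans a<b b<c)) ∷ (ℕ.z<s , ℕ.s<s b<c) ∷ []

  cone-unique : Unique (cone f)
  cone-unique = (third-differs b≢c ∷ second-differs a≢b ∷ []) ∷ (second-differs a≢b ∷ []) ∷ [] ∷ []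
    where
    second-differs : ∀ {x y : Fin n} {x′ y′ : Fin (suc n)} → x ≢ y → _≢_ {A = Tri (suc n)} (zero , suc x , x′) (zero , suc y , y′)
    second-differs x≢y refl = x≢y refl
    third-differs : ∀ {x y : Fin n} {x′ : Fin (suc n)} → x ≢ y → _≢_ {A = Tri (suc n)} (zero , x′ , suc x) (zero , x′ , suc y)
    third-differs x≢y refl = x≢y refl

  private
    a∉bc : suc a ∉T (zero , suc b , suc c)
    a∉bc = λ { (inj₂ (inj₁ refl)) → a≢b refl ; (inj₂ (inj₂ refl)) → a≢c refl }
    b∉ac : suc b ∉T (zero , suc a , suc c)
    b∉ac = λ { (inj₂ (inj₁ refl)) → a≢b refl ; (inj₂ (inj₂ refl)) → b≢c refl }
    c∉ab : suc c ∉T (zero , suc a , suc b)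
    c∉ab = λ { (inj₂ (inj₁ refl)) → a≢c refl ; (inj₂ (inj₂ refl)) → b≢c refl }

    count-ab : EdgeCount (suc a) (suc b) (cone f) 1
    count-ab = (inj₂ (inj₁ refl) , inj₂ (inj₂ refl)) ∈∷ b∉ac ∘ proj₂ ∉∷ a∉bc ∘ proj₁ ∉∷ []
    count-ac : EdgeCount (suc a) (suc c) (cone f) 1
    count-ac = c∉ab ∘ proj₂ ∉∷ (inj₂ (inj₁ refl) , inj₂ (inj₂ refl)) ∈∷ a∉bc ∘ proj₁ ∉∷ []
    count-bc : EdgeCount (suc b) (suc c) (cone f) 1
    count-bc = c∉ab ∘ proj₂ ∉∷ b∉ac ∘ proj₁ ∉∷ (inj₂ (inj₁ refl) , inj₂ (inj₂ refl)) ∈∷ []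

    count-0a : EdgeCount zero (suc a) (cone f) 2
    count-0a = (inj₁ refl , inj₂ (inj₁ refl)) ∈∷ (inj₁ refl , inj₂ (inj₁ refl)) ∈∷ a∉bc ∘ proj₂ ∉∷ []
    count-0b : EdgeCount zero (suc b) (cone f) 2
    count-0b = (inj₁ refl , inj₂ (inj₂ refl)) ∈∷ b∉ac ∘ proj₂ ∉∷ (inj₁ refl , inj₂ (inj₁ refl)) ∈∷ []
    count-0c : EdgeCount zero (suc c) (cone f) 2
    count-0c = c∉ab ∘ proj₂ ∉∷ (inj₁ refl , inj₂ (inj₂ refl)) ∈∷ (inj₁ refl , inj₂ (inj₂ refl)) ∈∷ []

  corner-avoiding : ∀ x y → ∃ λ z → z ∈T f × z ≢ x × z ≢ y
  corner-avoiding x y with a ≟ x | a ≟ y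
  ... | no a≢x | no a≢y = a , inj₁ refl , a≢x , a≢y
  ... | yes refl | _ with b ≟ y
  ...   | no b≢y = b , inj₂ (inj₁ refl) , a≢b ∘ sym , b≢y
  ...   | yes refl = c , inj₂ (inj₂ refl) , a≢c ∘ sym , b≢c ∘ sym
  corner-avoiding x y | no a≢x | yes refl with b ≟ x
  ...   | no b≢x = b , inj₂ (inj₁ refl) , b≢x , a≢b ∘ sym
  ...   | yes refl = c , inj₂ (inj₂ refl) , b≢c ∘ sym , a≢c ∘ sym

  corner-outside : ∀ {S} → Ordered S → S ≢ f → ∃ λ z → z ∈T f × z ∉T S
  corner-outside {S@(_ , _ , _)} (p<q , q<r) S≢f with a ∈T? S | b ∈T? S | c ∈T? S
  ... | no a∉S | _ | _ = a , inj₁ refl , a∉S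
  ... | yes _ | no b∉S | _ = b , inj₂ (inj₁ refl) , b∉S
  ... | yes _ | yes _ | no c∉S = c , inj₂ (inj₂ refl) , c∉S
  ... | yes a∈S | yes b∈S | yes c∈S = ⊥-elim (S≢f (sorted-∈T-unique p<q q<r a<b b<c a∈S b∈S c∈S))

  cone-apex-form : ∀ {g} → g ∈ cone f → ∃ λ q → ∃ λ r → g ≡ (zero , suc q , suc r)
  cone-apex-form (here refl) = _ , _ , refl
  cone-apex-form (there (here refl)) = _ , _ , refl
  cone-apex-form (there (there (here refl))) = _ , _ , refl

  cone-sucT-disjoint : ∀ {F g} → g ∈ cone f → ¬ g ∈ map sucT F
  cone-sucT-disjoint g∈cone g∈sucT with _ , _ , refl ← ∈-map⁻ sucT g∈sucT = zero∉sucT (zero∈cone g∈cone)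

  edgeDeg-cone-apex : ∀ {v} → v ∈T f → edgeDeg (cone f) zero (suc v) ≡ 2
  edgeDeg-cone-apex (inj₁ refl) = edgeDeg-count count-0a
  edgeDeg-cone-apex (inj₂ (inj₁ refl)) = edgeDeg-count count-0b
  edgeDeg-cone-apex (inj₂ (inj₂ refl)) = edgeDeg-count count-0c

  edgeDeg-cone-edge : ∀ {u v} → u ∈T f → v ∈T f → u ≢ v → edgeDeg (cone f) (suc u) (suc v) ≡ 1
  edgeDeg-cone-edge (inj₁ refl) (inj₂ (inj₁ refl)) _ = edgeDeg-count count-ab
  edgeDeg-cone-edge (inj₁ refl) (inj₂ (inj₂ refl)) _ = edgeDeg-count count-ac
  edgeDeg-cone-edge (inj₂ (inj₁ refl)) (inj₂ (inj₂ refl)) _ = edgeDeg-count count-bc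
  edgeDeg-cone-edge (inj₂ (inj₁ refl)) (inj₁ refl) _ = edgeDeg-count (EdgeCount-swap count-ab)
  edgeDeg-cone-edge (inj₂ (inj₂ refl)) (inj₁ refl) _ = edgeDeg-count (EdgeCount-swap count-ac)
  edgeDeg-cone-edge (inj₂ (inj₂ refl)) (inj₂ (inj₁ refl)) _ = edgeDeg-count (EdgeCount-swap count-bc)
  edgeDeg-cone-edge (inj₁ refl) (inj₁ refl) u≢u = ⊥-elim (u≢u refl)
  edgeDeg-cone-edge (inj₂ (inj₁ refl)) (inj₂ (inj₁ refl)) u≢u = ⊥-elim (u≢u refl)
  edgeDeg-cone-edge (inj₂ (inj₂ refl)) (inj₂ (inj₂ refl)) u≢u = ⊥-elim (u≢u refl)

  edgeDeg-cone : ∀ {u v} → u ≢ v → edgeDeg (cone f) (suc u) (suc v) ≡ edgeDeg (f ∷ []) u v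
  edgeDeg-cone {u} {v} u≢v with u ∈T? f ×-dec v ∈T? f
  ... | yes (u∈f , v∈f) = trans (edgeDeg-cone-edge u∈f v∈f u≢v) (sym (edgeDeg-count ((u∈f , v∈f) ∈∷ [])))
  ... | no uv∉f = trans (edgeDeg-count {F = cone f} (EdgeCount-none λ g∈ (u∈g , v∈g) → uv∉f (cone-∈T⁻ g∈ u∈g , cone-∈T⁻ g∈ v∈g)))
                        (sym (edgeDeg-count (uv∉f ∉∷ [])))

module Stack {n} (T : Triangulation n) {a b c : Fin n} (xs ys : List (Tri n))
             (split : Triangulation.faces T ≡ xs ++ (a , b , c) ∷ ys) where

  open Triangulation T

  f : Tri n
  f = a , b , c

  f∈faces : f ∈ faces
  f∈faces = subst (f ∈_) (sym split) (∈-++⁺ʳ xs (here refl))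

  f-ordered : Ordered f
  f-ordered = All.lookup ordered f∈faces

  open Cone (proj₁ f-ordered) (proj₂ f-ordered) public

  rest : List (Tri n)
  rest = xs ++ ys

  rest⊆faces : ∀ {g} → g ∈ rest → g ∈ faces
  rest⊆faces = subst (_ ∈_) (sym split) ∘ ∈-++-insert xs

  faces-split : ∀ {g} → g ∈ faces → g ≡ f ⊎ g ∈ rest
  faces-split = ∈-++-remove xs ∘ subst (_ ∈_) split

  f∉rest : All (f ≢_) rest
  f∉rest = proj₁ (Unique-remove xs (subst Unique split unique))

  faces⁺ : List (Tri (suc n))
  faces⁺ = cone f ++ map sucT rest

  cone⊆faces⁺ : ∀ {g} → g ∈ cone f → g ∈ faces⁺
  cone⊆faces⁺ = ∈-++⁺ˡ

  sucT-rest⊆faces⁺ : ∀ {g} → g ∈ rest → sucT g ∈ faces⁺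
  sucT-rest⊆faces⁺ = ∈-++⁺ʳ (cone f) ∘ ∈-map⁺ sucT

  faces⁺-split : ∀ {g′} → g′ ∈ faces⁺ → g′ ∈ cone f ⊎ ∃ λ g → g ∈ rest × g′ ≡ sucT g
  faces⁺-split = Data.Sum.map₂ (∈-map⁻ sucT) ∘ ∈-++⁻ (cone f)

  G : Graph n
  G⁺ : Graph (suc n)
  G = Adj faces
  G⁺ = Adj faces⁺

  Adj-suc⁻ : ∀ {u v} → G⁺ (suc u) (suc v) → G u v
  Adj-suc⁻ (u≢v , g′ , g′∈ , u∈g′ , v∈g′) with faces⁺-split g′∈
  ... | inj₁ g′∈cone = u≢v ∘ cong suc , f , f∈faces , cone-∈T⁻ g′∈cone u∈g′ , cone-∈T⁻ g′∈cone v∈g′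
  ... | inj₂ (g , g∈ , refl) = u≢v ∘ cong suc , g , rest⊆faces g∈ , ∈T-sucT⁻ u∈g′ , ∈T-sucT⁻ v∈g′

  Adj-suc⁺ : ∀ {u v} → G u v → G⁺ (suc u) (suc v)
  Adj-suc⁺ (u≢v , g , g∈ , u∈g , v∈g) with faces-split g∈
  ... | inj₂ g∈rest = u≢v ∘ Fin.suc-injective , sucT g , sucT-rest⊆faces⁺ g∈rest , ∈T-sucT⁺ u∈g , ∈T-sucT⁺ v∈g
  ... | inj₁ refl with g′ , g′∈ , u∈g′ , v∈g′ ← cone-face u∈g v∈g =
    u≢v ∘ Fin.suc-injective , g′ , cone⊆faces⁺ g′∈ , u∈g′ , v∈g′

  Adj-zero⁻ : ∀ {v} → G⁺ zero (suc v) → v ∈T f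
  Adj-zero⁻ (_ , g′ , g′∈ , zero∈g′ , v∈g′) with faces⁺-split g′∈
  ... | inj₁ g′∈cone = cone-∈T⁻ g′∈cone v∈g′
  ... | inj₂ (g , _ , refl) = ⊥-elim (zero∉sucT zero∈g′)

  Adj-zero⁺ : ∀ {v} → v ∈T f → G⁺ zero (suc v)
  Adj-zero⁺ v∈f with g′ , g′∈ , v∈g′ , _ ← cone-face v∈f v∈f = (λ ()) , g′ , cone⊆faces⁺ g′∈ , zero∈cone g′∈ , v∈g′

  lift : ∀ {u v} → Star G u v → Star G⁺ (suc u) (suc v)
  lift = Star.gmap suc Adj-suc⁺

  ordered⁺ : All Ordered faces⁺
  ordered⁺ = All.++⁺ cone-ordered (All.map⁺ (All.tabulate (sucT-ordered ∘ All.lookup ordered ∘ rest⊆faces)))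

  unique⁺ : Unique faces⁺
  unique⁺ = Unique.++⁺ cone-unique (Unique.map⁺ sucT-injective (proj₂ (Unique-remove xs (subst Unique split unique))))
    λ (g∈cone , g∈rest) → cone-sucT-disjoint g∈cone g∈rest

  edge-two⁺ : ∀ u′ v′ → G⁺ u′ v′ → edgeDeg faces⁺ u′ v′ ≡ 2
  edge-two⁺ zero zero (0≢0 , _) = ⊥-elim (0≢0 refl)
  edge-two⁺ zero (suc v) adj = begin
    edgeDeg faces⁺ zero (suc v)                                           ≡⟨ edgeDeg-++ (cone f) (map sucT rest) zero (suc v) ⟩
    edgeDeg (cone f) zero (suc v) + edgeDeg (map sucT rest) zero (suc v) ≡⟨ cong₂ _+_ (edgeDeg-cone-apex (Adj-zero⁻ adj))
                                                                                        (edgeDeg-map-sucT-zero rest (suc v)) ⟩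
    2                                                                     ∎
    where open ≡-Reasoning
  edge-two⁺ (suc u) zero adj = trans (edgeDeg-sym faces⁺ (suc u) zero) (edge-two⁺ zero (suc u) (Adj-sym adj))
  edge-two⁺ (suc u) (suc v) adj = begin
    edgeDeg faces⁺ (suc u) (suc v)                                                ≡⟨ edgeDeg-++ (cone f) (map sucT rest) (suc u) (suc v) ⟩
    edgeDeg (cone f) (suc u) (suc v) + edgeDeg (map sucT rest) (suc u) (suc v) ≡⟨ cong₂ _+_ (edgeDeg-cone (proj₁ (Adj-suc⁻ adj)))
                                                                                                 (edgeDeg-map-sucT rest u v) ⟩
    edgeDeg (f ∷ []) u v + edgeDeg rest u v                                       ≡⟨ edgeDeg-insert xs u v ⟨
    edgeDeg (xs ++ f ∷ ys) u v                                                    ≡⟨ cong (λ F → edgeDeg F u v) split ⟨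
    edgeDeg faces u v                                                             ≡⟨ edge-two u v (Adj-suc⁻ adj) ⟩
    2                                                                             ∎
    where open ≡-Reasoning

  L : Fin n → Graph n
  L⁺ : Fin (suc n) → Graph (suc n)
  L = LinkAdj faces
  L⁺ = LinkAdj faces⁺

  link-step : ∀ {v x y} → L v x y → Star (L⁺ (suc v)) (suc x) (suc y)
  link-step (v≢x , v≢y , x≢y , g , g∈ , v∈g , x∈g , y∈g) with faces-split g∈
  ... | inj₂ g∈rest =
    (v≢x ∘ Fin.suc-injective , v≢y ∘ Fin.suc-injective , x≢y ∘ Fin.suc-injective ,
     sucT g , sucT-rest⊆faces⁺ g∈rest , ∈T-sucT⁺ v∈g , ∈T-sucT⁺ x∈g , ∈T-sucT⁺ y∈g) ◅ ε
  ... | inj₁ refl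
    with g₁ , g₁∈ , v∈g₁ , x∈g₁ ← cone-face v∈g x∈g | g₂ , g₂∈ , v∈g₂ , y∈g₂ ← cone-face v∈g y∈g =
    (v≢x ∘ Fin.suc-injective , (λ ()) , (λ ()) , g₁ , cone⊆faces⁺ g₁∈ , v∈g₁ , x∈g₁ , zero∈cone g₁∈) ◅
    ((λ ()) , v≢y ∘ Fin.suc-injective , (λ ()) , g₂ , cone⊆faces⁺ g₂∈ , v∈g₂ , zero∈cone g₂∈ , y∈g₂) ◅ ε

  apex-link : ∀ {x y} → x ∈T f → y ∈T f → Star (L⁺ zero) (suc x) (suc y)
  apex-link {x} {y} x∈f y∈f with x ≟ y
  ... | yes refl = ε
  ... | no x≢y with g , g∈ , x∈g , y∈g ← cone-face x∈f y∈f =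
    ((λ ()) , (λ ()) , x≢y ∘ Fin.suc-injective , g , cone⊆faces⁺ g∈ , zero∈cone g∈ , x∈g , y∈g) ◅ ε

  link-from-apex : ∀ {v y} → G⁺ (suc v) zero → G⁺ (suc v) (suc y) → Star (L⁺ (suc v)) zero (suc y)
  link-from-apex {v} {y} v~0 v~y
    with v∈f ← Adj-zero⁻ (Adj-sym v~0)
    with z , z∈f , z≢v , _ ← corner-avoiding v v
    with g , g∈ , v∈g , z∈g ← cone-face v∈f z∈f =
    ((λ ()) , (z≢v ∘ sym) ∘ Fin.suc-injective , (λ ()) , g , cone⊆faces⁺ g∈ , v∈g , zero∈cone g∈ , z∈g) ◅
    Star.kleisliStar suc link-step (link-conn v z y (z≢v ∘ sym , f , f∈faces , v∈f , z∈f) (Adj-suc⁻ v~y))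

  link-conn⁺ : ∀ v′ x′ y′ → G⁺ v′ x′ → G⁺ v′ y′ → Star (L⁺ v′) x′ y′
  link-conn⁺ zero zero _ (0≢0 , _) _ = ⊥-elim (0≢0 refl)
  link-conn⁺ zero (suc _) zero _ (0≢0 , _) = ⊥-elim (0≢0 refl)
  link-conn⁺ zero (suc x) (suc y) 0~x 0~y = apex-link (Adj-zero⁻ 0~x) (Adj-zero⁻ 0~y)
  link-conn⁺ (suc v) (suc x) (suc y) v~x v~y =
    Star.kleisliStar suc link-step (link-conn v x y (Adj-suc⁻ v~x) (Adj-suc⁻ v~y))
  link-conn⁺ (suc v) zero (suc y) v~0 v~y = link-from-apex v~0 v~y
  link-conn⁺ (suc v) (suc x) zero v~x v~0 = Star.reverse LinkAdj-sym (link-from-apex v~0 v~x)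
  link-conn⁺ (suc v) zero zero _ _ = ε

  to-apex : ∀ v → Star G⁺ (suc v) zero
  to-apex v = lift (connected v a) ◅◅ Adj-sym (Adj-zero⁺ (inj₁ refl)) ◅ ε

  connected⁺ : Connected G⁺
  connected⁺ zero zero = ε
  connected⁺ zero (suc v) = Star.reverse Adj-sym (to-apex v)
  connected⁺ (suc u) zero = to-apex u
  connected⁺ (suc u) (suc v) = lift (connected u v)

  euler⁺ : length faces⁺ + 4 ≡ 2 * suc n
  euler⁺ = begin
    length faces⁺ + 4                ≡⟨ cong (λ k → 3 + k + 4) (List.length-map sucT rest) ⟩
    2 + (suc (length rest) + 4)      ≡⟨ cong (λ k → 2 + (k + 4)) (length-insert xs) ⟨
    2 + (length (xs ++ f ∷ ys) + 4)  ≡⟨ cong (λ F → 2 + (length F + 4)) split ⟨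
    2 + (length faces + 4)           ≡⟨ cong (2 +_) euler ⟩
    2 + 2 * n                        ≡⟨ ℕ.*-suc 2 n ⟨
    2 * suc n                        ∎
    where open ≡-Reasoning

  stacked : Triangulation (suc n)
  stacked = record
    { faces = faces⁺
    ; four≤n = ℕ.m≤n⇒m≤1+n four≤n
    ; ordered = ordered⁺
    ; unique = unique⁺
    ; edge-two = edge-two⁺
    ; link-conn = link-conn⁺
    ; connected = connected⁺
    ; euler = euler⁺
    }

  lift─ : ∀ {S S′} → (∀ {t} → suc t ∈T S′ → t ∈T S) → ∀ {u v} → Star (G ─ S) u v → Star (G⁺ ─ S′) (suc u) (suc v)
  lift─ back = Star.gmap suc λ (u∉S , v∉S , adj) → u∉S ∘ back , v∉S ∘ back , Adj-suc⁺ adj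

  apex-isolated : ∀ {y′} → ¬ (G⁺ ─ sucT f) zero y′
  apex-isolated {zero} (_ , _ , 0≢0 , _) = 0≢0 refl
  apex-isolated {suc y} (_ , y∉ , 0~y) = y∉ (∈T-sucT⁺ (Adj-zero⁻ 0~y))

  new-cut : IsCut G⁺ (sucT f)
  new-cut with t , t∉f ← ∃∉T four≤n f =
    zero , suc t , zero∉sucT , t∉f ∘ ∈T-sucT⁻ , connected⁺ zero (suc t) , λ { (step ◅ _) → apex-isolated step }

  -- A path avoiding sucT S projects to a path avoiding S by sending the apex to z.
  module _ {S} {z} (z∈f : z ∈T f) (z∉S : z ∉T S) where

    private
      project : Fin (suc n) → Fin n
      project zero = z
      project (suc x) = x

      corner-to-z : ∀ {x} → x ∈T f → x ∉T S → Star (G ─ S) x z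
      corner-to-z {x} x∈f x∉S with x ≟ z
      ... | yes refl = ε
      ... | no x≢z = (x∉S , z∉S , x≢z , f , f∈faces , x∈f , z∈f) ◅ ε

      project-step : ∀ {x′ y′} → (G⁺ ─ sucT S) x′ y′ → Star (G ─ S) (project x′) (project y′)
      project-step {zero} {zero} _ = ε
      project-step {zero} {suc y} (_ , y∉ , 0~y) = Star.reverse Adj─-sym (corner-to-z (Adj-zero⁻ 0~y) (y∉ ∘ ∈T-sucT⁺))
      project-step {suc x} {zero} (x∉ , _ , x~0) = corner-to-z (Adj-zero⁻ (Adj-sym x~0)) (x∉ ∘ ∈T-sucT⁺)
      project-step {suc x} {suc y} (x∉ , y∉ , x~y) = (x∉ ∘ ∈T-sucT⁺ , y∉ ∘ ∈T-sucT⁺ , Adj-suc⁻ x~y) ◅ ε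

      to-project : ∀ {u′} → u′ ∉T sucT S → Star (G⁺ ─ sucT S) u′ (suc (project u′))
      to-project {zero} 0∉ = (0∉ , z∉S ∘ ∈T-sucT⁻ , Adj-zero⁺ z∈f) ◅ ε
      to-project {suc u} _ = ε

    IsCut-sucT⁻ : IsCut G⁺ (sucT S) → IsCut G S
    IsCut-sucT⁻ (u′ , v′ , u′∉ , v′∉ , _ , ¬path′) =
      project u′ , project v′ , project-∉ u′∉ , project-∉ v′∉ , connected _ _ ,
      λ path → ¬path′ (to-project u′∉ ◅◅ lift─ ∈T-sucT⁻ path ◅◅ Star.reverse Adj─-sym (to-project v′∉))
      where
      project-∉ : ∀ {u′} → u′ ∉T sucT S → project u′ ∉T S
      project-∉ {zero} _ = z∉S
      project-∉ {suc u} u′∉ = u′∉ ∘ ∈T-sucT⁺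

    IsCut-sucT⁺ : IsCut G S → IsCut G⁺ (sucT S)
    IsCut-sucT⁺ (u , v , u∉ , v∉ , path , ¬path) =
      suc u , suc v , u∉ ∘ ∈T-sucT⁻ , v∉ ∘ ∈T-sucT⁻ , lift path , ¬path ∘ Star.kleisliStar project project-step

  module _ (three-connected : ThreeConnected G) where

    private
      apex-Connected─ : ∀ {S′ q r} → zero ∈T S′ → (∀ {t} → suc t ∈T S′ → t ∈T (q , r , r)) →
                        (∀ {t} → t ∈T (q , r , r) → suc t ∈T S′) → Connected─ G⁺ S′
      apex-Connected─ 0∈ _ _ {zero} u∉ _ = ⊥-elim (u∉ 0∈)
      apex-Connected─ 0∈ _ _ {suc _} {zero} _ v∉ = ⊥-elim (v∉ 0∈)
      apex-Connected─ {q = q} {r} _ back fwd {suc _} {suc _} u∉ v∉ =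
        lift─ back (three-connected q r (u∉ ∘ fwd) (v∉ ∘ fwd))

    apex-triple-Connected─ : ∀ q r → Connected─ G⁺ (zero , suc q , suc r)
    apex-triple-Connected─ q r = apex-Connected─ (inj₁ refl)
      (λ { (inj₁ ()) ; (inj₂ (inj₁ refl)) → inj₁ refl ; (inj₂ (inj₂ refl)) → inj₂ (inj₁ refl) })
      (λ { (inj₁ refl) → inj₂ (inj₁ refl) ; (inj₂ (inj₁ refl)) → inj₂ (inj₂ refl) ; (inj₂ (inj₂ refl)) → inj₂ (inj₂ refl) })

    three-connected⁺ : ThreeConnected G⁺
    three-connected⁺ zero (suc y) = apex-triple-Connected─ y y
    three-connected⁺ (suc x) zero = apex-Connected─ (inj₂ (inj₁ refl))
      (λ { (inj₁ refl) → inj₁ refl ; (inj₂ (inj₁ ())) ; (inj₂ (inj₂ ())) })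
      (λ { (inj₁ refl) → inj₁ refl ; (inj₂ (inj₁ refl)) → inj₁ refl ; (inj₂ (inj₂ refl)) → inj₁ refl })
    three-connected⁺ zero zero {zero} 0∉ _ = ⊥-elim (0∉ (inj₁ refl))
    three-connected⁺ zero zero {suc _} {zero} _ 0∉ = ⊥-elim (0∉ (inj₁ refl))
    three-connected⁺ zero zero {suc u} {suc v} _ _ = Star.gmap suc (λ x~y → suc∉zeros , suc∉zeros , Adj-suc⁺ x~y) (connected u v)
      where
      suc∉zeros : ∀ {t} → suc t ∉T (zero , zero , zero)
      suc∉zeros = λ { (inj₁ ()) ; (inj₂ (inj₁ ())) ; (inj₂ (inj₂ ())) }
    three-connected⁺ (suc x) (suc y) u′∉ v′∉ = to-z u′∉ ◅◅ Star.reverse Adj─-sym (to-z v′∉)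
      where
      z-avoiding : ∃ λ z → z ∈T f × z ≢ x × z ≢ y
      z-avoiding = corner-avoiding x y
      z : Fin n
      z = proj₁ z-avoiding
      z∉ : z ∉T (x , y , y)
      z∉ = let _ , _ , z≢x , z≢y = z-avoiding in Data.Sum.[ z≢x , Data.Sum.[ z≢y , z≢y ] ]
      to-z : ∀ {t′} → t′ ∉T sucT (x , y , y) → Star (G⁺ ─ sucT (x , y , y)) t′ (suc z)
      to-z {zero} 0∉ = (0∉ , z∉ ∘ ∈T-sucT⁻ , Adj-zero⁺ (proj₁ (proj₂ z-avoiding))) ◅ ε
      to-z {suc t} t∉ = lift─ ∈T-sucT⁻ (three-connected x y (t∉ ∘ ∈T-sucT⁺) z∉)

-- Stages of the construction

record Stage (n d i m : ℕ) : Set where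
  field
    triangulation : Triangulation n
  open Triangulation triangulation using (faces; graph)
  field
    three-connected : ThreeConnected graph
    faces-not-cuts  : ∀ {g} → g ∈ faces → ¬ IsCut graph g
    exact-cuts      : Has3Cuts graph d
    independent     : List (Fin n)
    independent-unique : Unique independent
    independent-nonadjacent : ∀ {u v} → u ∈ independent → v ∈ independent → ¬ graph u v
    independent-length : length independent ≡ i
    free            : List (Tri n)
    free-unique     : Unique free
    free-faces      : ∀ {g} → g ∈ free → g ∈ faces
    free-avoids     : ∀ {g v} → g ∈ free → v ∈T g → ¬ v ∈ independent
    free-length     : length free ≡ m

  cuts : List (Tri n)
  cuts = proj₁ exact-cuts

  cuts-unique : Unique cuts
  cuts-unique = proj₁ (proj₂ exact-cuts)

  cuts-exact : ∀ S → S ∈ cuts ⇔ Is3Cut graph S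
  cuts-exact = proj₁ (proj₂ (proj₂ exact-cuts))

  cuts-length : length cuts ≡ d
  cuts-length = proj₂ (proj₂ (proj₂ exact-cuts))

module Step {n d i m} (s : Stage n d i (suc m)) {a b c rest-free}
            (free≡ : Stage.free s ≡ (a , b , c) ∷ rest-free) where

  open Stage s
  open Triangulation triangulation

  private
    f∈free : (a , b , c) ∈ free
    f∈free = subst ((a , b , c) ∈_) (sym free≡) (here refl)

    split : ∃ λ xs → ∃ λ ys → faces ≡ xs ++ (a , b , c) ∷ ys
    split = ∈-∃++ (free-faces f∈free)

  open Stack triangulation (proj₁ split) (proj₁ (proj₂ split)) (proj₂ (proj₂ split))

  f-not-cut : ¬ IsCut G f
  f-not-cut = faces-not-cuts f∈faces

  cuts⁺ : List (Tri (suc n))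
  cuts⁺ = sucT f ∷ map sucT cuts

  cuts⁺-unique : Unique cuts⁺
  cuts⁺-unique =
    All.map⁺ (All.tabulate λ S∈ f≡S → f-not-cut (subst (IsCut G) (sym (sucT-injective f≡S)) (proj₂ (Equivalence.to (cuts-exact _) S∈))))
    ∷ Unique.map⁺ sucT-injective cuts-unique

  cuts⁺-exact : ∀ S′ → S′ ∈ cuts⁺ ⇔ Is3Cut G⁺ S′
  cuts⁺-exact S′ = mk⇔ to from
    where
    to : S′ ∈ cuts⁺ → Is3Cut G⁺ S′
    to (here refl) = sucT-ordered f-ordered , new-cut
    to (there S′∈) with S , S∈ , refl ← ∈-map⁻ sucT S′∈ with S-ordered , S-cut ← Equivalence.to (cuts-exact S) S∈
      with z , z∈f , z∉S ← corner-outside S-ordered (λ { refl → f-not-cut S-cut }) =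
      sucT-ordered S-ordered , IsCut-sucT⁺ z∈f z∉S S-cut
    from : Is3Cut G⁺ S′ → S′ ∈ cuts⁺
    from (S′-ordered , S′-cut) with Ordered-view S′ S′-ordered
    ... | inj₂ (q , r , refl) = ⊥-elim (Connected─⇒¬IsCut (apex-triple-Connected─ three-connected q r) S′-cut)
    ... | inj₁ (S , refl , S-ordered) with S ≟T f
    ...   | yes refl = here refl
    ...   | no S≢f with z , z∈f , z∉S ← corner-outside S-ordered S≢f =
      there (∈-map⁺ sucT (Equivalence.from (cuts-exact S) (S-ordered , IsCut-sucT⁻ z∈f z∉S S′-cut)))

  exact-cuts⁺ : Has3Cuts G⁺ (suc d)
  exact-cuts⁺ = cuts⁺ , cuts⁺-unique , cuts⁺-exact ,
                cong suc (trans (List.length-map sucT cuts) cuts-length)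

  faces⁺-not-cuts : ∀ {g′} → g′ ∈ faces⁺ → ¬ IsCut G⁺ g′
  faces⁺-not-cuts g′∈ with faces⁺-split g′∈
  ... | inj₁ g′∈cone with q , r , refl ← cone-apex-form g′∈cone =
    Connected─⇒¬IsCut (apex-triple-Connected─ three-connected q r)
  ... | inj₂ (g , g∈rest , refl)
    with z , z∈f , z∉g ← corner-outside (All.lookup ordered (rest⊆faces g∈rest)) (All.lookup f∉rest g∈rest ∘ sym) =
    faces-not-cuts (rest⊆faces g∈rest) ∘ IsCut-sucT⁻ z∈f z∉g

  private
    f∈free∷ : ∀ {g} → g ∈ (a , b , c) ∷ rest-free → g ∈ free
    f∈free∷ = subst (_ ∈_) (sym free≡)

    f∉rest-free : All (f ≢_) rest-free
    f∉rest-free = proj₁ (Unique-remove [] (subst Unique free≡ free-unique))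

    rest-free-unique : Unique rest-free
    rest-free-unique = proj₂ (Unique-remove [] (subst Unique free≡ free-unique))

  f-avoids : ∀ {v} → v ∈T f → ¬ v ∈ independent
  f-avoids = free-avoids (f∈free∷ (here refl))

  rest-free⊆rest : ∀ {g} → g ∈ rest-free → g ∈ rest
  rest-free⊆rest g∈ with faces-split (free-faces (f∈free∷ (there g∈)))
  ... | inj₁ refl = ⊥-elim (All.lookup f∉rest-free g∈ refl)
  ... | inj₂ g∈rest = g∈rest

  rest-free-length : length rest-free ≡ m
  rest-free-length = ℕ.suc-injective (trans (cong length (sym free≡)) free-length)

  sucT-rest-free-faces : ∀ {g′} → g′ ∈ map sucT rest-free → g′ ∈ faces⁺
  sucT-rest-free-faces g′∈ with g , g∈ , refl ← ∈-map⁻ sucT g′∈ = sucT-rest⊆faces⁺ (rest-free⊆rest g∈)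

  sucT-rest-free-avoids : ∀ {g′ v′} → g′ ∈ map sucT rest-free → v′ ∈T g′ → ¬ v′ ∈ map suc independent
  sucT-rest-free-avoids g′∈ v′∈g′ v′∈ with g , g∈ , refl ← ∈-map⁻ sucT g′∈ | x , x∈ , refl ← ∈-map⁻ suc v′∈ =
    free-avoids (f∈free∷ (there g∈)) (∈T-sucT⁻ v′∈g′) x∈

  suc-independent-nonadjacent : ∀ {u′ v′} → u′ ∈ map suc independent → v′ ∈ map suc independent → ¬ G⁺ u′ v′
  suc-independent-nonadjacent u′∈ v′∈ u~v with x , x∈ , refl ← ∈-map⁻ suc u′∈ | y , y∈ , refl ← ∈-map⁻ suc v′∈ =
    independent-nonadjacent x∈ y∈ (Adj-suc⁻ u~v)

  apex-nonadjacent : ∀ {v′} → v′ ∈ map suc independent → ¬ G⁺ zero v′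
  apex-nonadjacent v′∈ 0~v with x , x∈ , refl ← ∈-map⁻ suc v′∈ = f-avoids (Adj-zero⁻ 0~v) x∈

  with-apex : Stage (suc n) (suc d) (suc i) m
  with-apex = record
    { triangulation = stacked
    ; three-connected = three-connected⁺ three-connected
    ; faces-not-cuts = faces⁺-not-cuts
    ; exact-cuts = exact-cuts⁺
    ; independent = zero ∷ map suc independent
    ; independent-unique = All.map⁺ (All.tabulate λ _ ()) ∷ Unique.map⁺ Fin.suc-injective independent-unique
    ; independent-nonadjacent = nonadjacent
    ; independent-length = cong suc (trans (List.length-map suc independent) independent-length)
    ; free = map sucT rest-free
    ; free-unique = Unique.map⁺ sucT-injective rest-free-unique
    ; free-faces = sucT-rest-free-faces
    ; free-avoids = λ { g′∈ v∈g′ (here refl) → let _ , _ , g′≡ = ∈-map⁻ sucT g′∈ in zero∉sucT (subst (zero ∈T_) g′≡ v∈g′)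
                      ; g′∈ v∈g′ (there v∈) → sucT-rest-free-avoids g′∈ v∈g′ v∈ }
    ; free-length = trans (List.length-map sucT rest-free) rest-free-length
    }
    where
    nonadjacent : ∀ {u′ v′} → u′ ∈ zero ∷ map suc independent → v′ ∈ zero ∷ map suc independent → ¬ G⁺ u′ v′
    nonadjacent (here refl) (here refl) (0≢0 , _) = 0≢0 refl
    nonadjacent (here refl) (there v∈) = apex-nonadjacent v∈
    nonadjacent (there u∈) (here refl) = apex-nonadjacent u∈ ∘ Adj-sym
    nonadjacent (there u∈) (there v∈) = suc-independent-nonadjacent u∈ v∈

  without-apex : Stage (suc n) (suc d) i (3 + m)
  without-apex = record
    { triangulation = stacked
    ; three-connected = three-connected⁺ three-connected
    ; faces-not-cuts = faces⁺-not-cuts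
    ; exact-cuts = exact-cuts⁺
    ; independent = map suc independent
    ; independent-unique = Unique.map⁺ Fin.suc-injective independent-unique
    ; independent-nonadjacent = suc-independent-nonadjacent
    ; independent-length = trans (List.length-map suc independent) independent-length
    ; free = cone f ++ map sucT rest-free
    ; free-unique = Unique.++⁺ cone-unique (Unique.map⁺ sucT-injective rest-free-unique)
                      λ (g∈cone , g∈sucT) → cone-sucT-disjoint g∈cone g∈sucT
    ; free-faces = Data.Sum.[ cone⊆faces⁺ , sucT-rest-free-faces ] ∘ ∈-++⁻ (cone f)
    ; free-avoids = λ g′∈ → Data.Sum.[ cone-avoids , sucT-rest-free-avoids ] (∈-++⁻ (cone f) g′∈)
    ; free-length = cong (3 +_) (trans (List.length-map sucT rest-free) rest-free-length)
    }
    where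
    cone-avoids : ∀ {g′ v′} → g′ ∈ cone f → v′ ∈T g′ → ¬ v′ ∈ map suc independent
    cone-avoids g′∈ v′∈g′ v′∈ with x , x∈ , refl ← ∈-map⁻ suc v′∈ = f-avoids (cone-∈T⁻ g′∈ v′∈g′) x∈

stack-independent : ∀ {n d i m} → Stage n d i (suc m) → Stage (suc n) (suc d) (suc i) m
stack-independent s with Stage.free s in free≡
... | (_ , _ , _) ∷ _ = Step.with-apex s free≡
... | [] with () ← trans (cong length (sym free≡)) (Stage.free-length s)

stack-free : ∀ {n d i m} → Stage n d i (suc m) → Stage (suc n) (suc d) i (3 + m)
stack-free s with Stage.free s in free≡
... | (_ , _ , _) ∷ _ = Step.without-apex s free≡
... | [] with () ← trans (cong length (sym free≡)) (Stage.free-length s)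

stack-independent-times : ∀ k {n d i m} → Stage n d i (k + m) → Stage (k + n) (k + d) (k + i) m
stack-independent-times zero s = s
stack-independent-times (suc k) {n} {d} {i} {m} s =
  stack-independent (stack-independent-times k (subst (Stage n d i) (sym (ℕ.+-suc k m)) s))

-- Checking small triangulations by evaluation

module Reachability {n} {R : Fin n → Fin n → Set} (R? : ∀ u v → Dec (R u v)) where

  step : Vec Bool n → Vec Bool n
  step r = Vec.tabulate λ v → Vec.lookup r v ∨ ⌊ Fin.any? (λ u → T? (Vec.lookup r u) ×-dec R? u v) ⌋

  reached : Fin n → ℕ → Vec Bool n
  reached root zero = Vec.tabulate λ v → ⌊ v ≟ root ⌋
  reached root (suc k) = step (reached root k)

  reached-sound : ∀ root k v → T (Vec.lookup (reached root k) v) → Star R root v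
  reached-sound root zero v t
    rewrite Vec.lookup∘tabulate (λ v → ⌊ v ≟ root ⌋) v with refl ← toWitness {a? = v ≟ root} t = ε
  reached-sound root (suc k) v t
    rewrite Vec.lookup∘tabulate (λ v → Vec.lookup (reached root k) v ∨
                                       ⌊ Fin.any? (λ u → T? (Vec.lookup (reached root k) u) ×-dec R? u v) ⌋) v
    with Equivalence.to T-∨ t
  ... | inj₁ t-old = reached-sound root k v t-old
  ... | inj₂ t-new with u , t-u , u~v ← toWitness {a? = Fin.any? (λ u → T? (Vec.lookup (reached root k) u) ×-dec R? u v)} t-new =
    reached-sound root k u t-u ◅◅ u~v ◅ ε

  reach : Fin n → Vec Bool n
  reach root = reached root n

  reach-sound : ∀ {root v} → T (Vec.lookup (reach root) v) → Star R root v
  reach-sound = reached-sound _ n _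

choose : ∀ {n} {P : Fin n → Set} → (∀ v → Dec (P v)) → Fin n → Fin n
choose P? default with Fin.any? P?
... | yes (v , _) = v
... | no _ = default

module Certificate {k} (F : List (Tri (suc k))) where

  private
    V : Set
    V = Fin (suc k)

  Adj? : ∀ (u v : V) → Dec (Adj F u v)
  Adj? u v = ¬? (u ≟ v) ×-dec
    Dec.map′ find (λ (g , g∈ , p) → lose g∈ p) (Any.any? (λ g → u ∈T? g ×-dec v ∈T? g) F)

  LinkAdj? : ∀ (v a b : V) → Dec (LinkAdj F v a b)
  LinkAdj? v a b = ¬? (v ≟ a) ×-dec ¬? (v ≟ b) ×-dec ¬? (a ≟ b) ×-dec
    Dec.map′ find (λ (g , g∈ , p) → lose g∈ p) (Any.any? (λ g → v ∈T? g ×-dec a ∈T? g ×-dec b ∈T? g) F)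

  _─?_ : ∀ (S : Tri (suc k)) (u v : V) → Dec ((Adj F ─ S) u v)
  (S ─? u) v = ¬? (u ∈T? S) ×-dec ¬? (v ∈T? S) ×-dec Adj? u v

  ordered? : Dec (All Ordered F)
  ordered? = All.all? (λ (a , b , c) → a Fin.<? b ×-dec b Fin.<? c) F

  unique? : Dec (Unique F)
  unique? = AllPairs.allPairs? (λ g h → ¬? (g ≟T h)) F

  edge-two? : Dec (∀ u v → Adj F u v → edgeDeg F u v ≡ 2)
  edge-two? = Fin.all? λ u → Fin.all? λ v → Adj? u v →-dec edgeDeg F u v ℕ.≟ 2

  link-reach? : Dec (∀ v a → Adj F v a → ∀ b → Adj F v b → T (Vec.lookup (Reachability.reach (LinkAdj? v) a) b))
  link-reach? = Fin.all? λ v → Fin.all? λ a → Adj? v a →-dec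
    Fin.all? λ b → Adj? v b →-dec T? (Vec.lookup (Reachability.reach (LinkAdj? v) a) b)

  connected? : Dec (∀ v → T (Vec.lookup (Reachability.reach Adj? zero) v))
  connected? = Fin.all? λ v → T? (Vec.lookup (Reachability.reach Adj? zero) v)

  -- Soundness of a reachability check does not depend on the root; a root outside S only
  -- makes the check succeed.
  separation-root : Tri (suc k) → V
  separation-root S = choose (λ v → ¬? (v ∈T? S)) zero

  separations? : Dec (∀ S v → v ∈T S ⊎ T (Vec.lookup (Reachability.reach (S ─?_) (separation-root S)) v))
  separations? = Dec.map′ (λ all-abc (a , b , c) → all-abc a b c) (λ all-S a b c → all-S (a , b , c))
    (Fin.all? λ a → Fin.all? λ b → Fin.all? λ c → let S = a , b , c in
      Fin.all? λ v → v ∈T? S ⊎-dec T? (Vec.lookup (Reachability.reach (S ─?_) (separation-root S)) v))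

  module Certified (4≤n : 4 ≤ suc k) (euler : length F + 4 ≡ 2 * suc k)
                   (ordered-ok : True ordered?) (unique-ok : True unique?) (edge-two-ok : True edge-two?)
                   (link-ok : True link-reach?) (connected-ok : True connected?) (separations-ok : True separations?)
                   where

    -- The arguments {a? = …} and {root = …} below are given explicitly: inferring them would make
    -- Agda unfold the checks on an arbitrary face list.
    private
      G : Graph (suc k)
      G = Adj F

      symmetric-reach : ∀ {R : V → V → Set} (R? : ∀ u v → Dec (R u v)) → (∀ {u v} → R u v → R v u) →
                        ∀ {root u v} → T (Vec.lookup (Reachability.reach R? root) u) →
                        T (Vec.lookup (Reachability.reach R? root) v) → Star R u v
      symmetric-reach R? R-sym root~u root~v =
        Star.reverse R-sym (Reachability.reach-sound R? root~u) ◅◅ Reachability.reach-sound R? root~v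

      separated : ∀ S → Connected─ G S
      separated S {u} {v} u∉S v∉S = symmetric-reach (S ─?_) Adj─-sym {root = separation-root S} (reached u∉S) (reached v∉S)
        where
        reached : ∀ {w} → w ∉T S → T (Vec.lookup (Reachability.reach (S ─?_) (separation-root S)) w)
        reached {w} w∉S = Data.Sum.fromInj₂ (⊥-elim ∘ w∉S) (toWitness {a? = separations?} separations-ok S w)

    triangulation : Triangulation (suc k)
    triangulation = record
      { faces = F
      ; four≤n = 4≤n
      ; ordered = toWitness {a? = ordered?} ordered-ok
      ; unique = toWitness {a? = unique?} unique-ok
      ; edge-two = toWitness {a? = edge-two?} edge-two-ok
      ; link-conn = λ v a b v~a v~b →
          symmetric-reach (LinkAdj? v) LinkAdj-sym
            {root = a} (toWitness {a? = link-reach?} link-ok v a v~a a v~a) (toWitness {a? = link-reach?} link-ok v a v~a b v~b)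
      ; connected = λ u v → symmetric-reach Adj? Adj-sym {root = zero} (toWitness {a? = connected?} connected-ok u) (toWitness {a? = connected?} connected-ok v)
      ; euler = euler
      }

    stage : Stage (suc k) 0 0 (length F)
    stage = record
      { triangulation = triangulation
      ; three-connected = λ x y → separated (x , y , y)
      ; faces-not-cuts = λ {g} _ → Connected─⇒¬IsCut (separated g)
      ; exact-cuts = [] , [] , (λ S → mk⇔ (λ ()) (λ (_ , S-cut) → ⊥-elim (Connected─⇒¬IsCut (separated S) S-cut))) , refl
      ; independent = []
      ; independent-unique = []
      ; independent-nonadjacent = λ ()
      ; independent-length = refl
      ; free = F
      ; free-unique = toWitness {a? = unique?} unique-ok
      ; free-faces = λ g∈ → g∈
      ; free-avoids = λ _ _ ()
      ; free-length = refl
      }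

octahedron-faces : List (Tri 6)
octahedron-faces =
  (# 0 , # 1 , # 2) ∷ (# 0 , # 2 , # 3) ∷ (# 0 , # 3 , # 4) ∷ (# 0 , # 1 , # 4) ∷
  (# 1 , # 2 , # 5) ∷ (# 2 , # 3 , # 5) ∷ (# 3 , # 4 , # 5) ∷ (# 1 , # 4 , # 5) ∷ []

bipyramid-faces : List (Tri 7)
bipyramid-faces =
  (# 0 , # 1 , # 2) ∷ (# 0 , # 2 , # 3) ∷ (# 0 , # 3 , # 4) ∷ (# 0 , # 4 , # 5) ∷ (# 0 , # 1 , # 5) ∷
  (# 1 , # 2 , # 6) ∷ (# 2 , # 3 , # 6) ∷ (# 3 , # 4 , # 6) ∷ (# 4 , # 5 , # 6) ∷ (# 1 , # 5 , # 6) ∷ []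

octahedron : Stage 6 0 0 8
octahedron = Certificate.Certified.stage octahedron-faces (s≤s (s≤s (s≤s (s≤s z≤n)))) refl tt tt tt tt tt tt

bipyramid : Stage 7 0 0 10
bipyramid = Certificate.Certified.stage bipyramid-faces (s≤s (s≤s (s≤s (s≤s z≤n)))) refl tt tt tt tt tt tt

NonTraceableWith3Cuts : ℕ → Set
NonTraceableWith3Cuts d =
  Σ ℕ λ n → Σ (Triangulation n) λ T → ¬ Traceable (Triangulation.graph T) × Has3Cuts (Triangulation.graph T) d

finish : ∀ {n d i m} → Stage n d i m → n + 2 ≤ i + i → NonTraceableWith3Cuts d
finish {n} s n+2≤2i = n , triangulation ,
  large-independent⇒¬Traceable independent-unique independent-nonadjacent
    (subst (λ l → n + 2 ≤ l + l) (sym independent-length) n+2≤2i) ,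
  exact-cuts
  where open Stage s

Balanced : ℕ → Set
Balanced d = ∃ λ n → ∃ λ i → ∃ λ m → Stage n d i (suc m) × n + 2 ≤ i + i

balanced-9 : Balanced 9
balanced-9 = 16 , 9 , 0 , stack-independent-times 9 bipyramid , ℕ.≤-refl

-- stacking a free vertex and then an independent one adds 2 to both sides of n + 2 ≤ 2i
balanced-+2 : ∀ {d} → Balanced d → Balanced (2 + d)
balanced-+2 (n , i , m , s , n+2≤2i) =
  2 + n , suc i , suc m , stack-independent (stack-free s) ,
  subst (2 + n + 2 ≤_) (cong suc (sym (ℕ.+-suc i i))) (s≤s (s≤s n+2≤2i))

balanced⇒result : ∀ {d} → Balanced d → ∀ j → NonTraceableWith3Cuts (j + d)
balanced⇒result (_ , _ , _ , s , n+2≤2i) zero = finish s n+2≤2i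
balanced⇒result (_ , i , _ , s , n+2≤2i) (suc zero) =
  finish (stack-independent s) (s≤s (ℕ.≤-trans n+2≤2i (ℕ.+-monoʳ-≤ i (ℕ.n≤1+n i))))
balanced⇒result {d} b (suc (suc j)) =
  subst NonTraceableWith3Cuts (trans (ℕ.+-suc j (suc d)) (cong suc (ℕ.+-suc j d))) (balanced⇒result (balanced-+2 b) j)

lemma7 : (d : ℕ) → 8 ≤ d →
    Σ ℕ λ n → Σ (Triangulation n) λ T →
      ¬ Traceable (Triangulation.graph T) × Has3Cuts (Triangulation.graph T) d
lemma7 d 8≤d with ℕ.m≤n⇒∃[o]m+o≡n 8≤d
... | zero , refl = finish (stack-independent-times 8 octahedron) ℕ.≤-refl
... | suc j , refl = subst NonTraceableWith3Cuts (ℕ.+-comm j 9) (balanced⇒result balanced-9 j)
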